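{- Let $T=\Box^{\mathsf{ns}}[a\leftrightarrow x\,\mathsf{UM}_{I,\#b=k\%n}\,y]$ be a temporal definition built from $\Sigma\cup W$, with $a\in W$ and $x,y,b\in\Sigma\cup W$. Then one can synthesize an $\mathsf{MTL}$ formula $\psi$ over $\Sigma\cup W\cup X$, for a set $X$ of fresh propositions, which is equivalent to $T$ modulo simple extensions.
   Context: Finite timed words over a proposition set $\Sigma_0$: $\rho=(\sigma,\tau)$, $\sigma_i\subseteq\Sigma_0$ nonempty, $\tau_i\in\mathbb{R}_{\ge0}$, $\tau_1=0$, $\tau_i\le\tau_{i+1}$. $\mathsf{MTL}$ uses the strict until $\rho,i\models\varphi_1\mathsf{U}_I\varphi_2$ iff some $j>i$ has $\rho,j\models\varphi_2$, $\tau_j-\tau_i\in I$, $\rho,k\models\varphi_1$ for $i<k<j$ (intervals with endpoints in $\mathbb{N}\cup\{\infty\}$); $\Box^{\mathsf{ns}}\varphi$ means $\varphi$ holds at the current position and all later ones; $\rho\models\varphi$ iff $\rho,1\models\varphi$. For $0\le k\le n-1$: $\rho,i\models x\,\mathsf{UM}_{I,\#b=k\%n}\,y$ iff some $j>i$ has $\tau_j-\tau_i\in I$, $\rho,j\models y$, $\rho,l\models x$ for all $i<l<j$, and the number of positions $l$ with $i<l<j$ and $b\in\sigma_l$ is congruent to $k$ modulo $n$. A simple extension of $\rho$ over $\Sigma_0$ into $\Sigma'\supseteq\Sigma_0$ is a timed word $\rho'$ with the same positions and time stamps and labels $\sigma_i\cup Y_i$, $Y_i\subseteq\Sigma'\setminus\Sigma_0$.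 A formula $\psi$ over $\Sigma'$ is equivalent to $\varphi$ over $\Sigma_0$ modulo simple extensions if for every $\rho$ over $\Sigma_0$: $\rho\models\varphi$ iff some simple extension $\rho'$ of $\rho$ into $\Sigma'$ satisfies $\psi$, and the restriction to $\Sigma_0$ of any model of $\psi$ is a model of $\varphi$. Here $\Sigma_0=\Sigma\cup W$, $\Sigma'=\Sigma\cup W\cup X$.
   Formalization: The time stamps $\tau_i$ of all timed words are non-negative rationals instead of elements of $\mathbb{R}_{\ge0}$. -}

module Defs where

open import Data.Bool using (Bool; true; false; _∧_; _∨_; if_then_else_)
open import Data.Nat as ℕ using (ℕ; zero; suc; NonZero)
open import Data.Nat.DivMod using (_%_)
open import Data.Fin as Fin using (Fin)
open import Data.Fin.Properties using () renaming (_<?_ to _<ᶠ?_)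
open import Data.Integer using (+_)
open import Data.Rational as ℚ using (ℚ; 0ℚ; _-_; _/_)
open import Data.Maybe using (Maybe; just; nothing)
open import Data.List using (List; length; filter; _++_)
open import Data.List.Membership.Propositional using (_∈_)
open import Data.List.Membership.DecPropositional ℕ._≟_ using (_∈?_)
open import Data.Product using (Σ; ∃; _×_; _,_)
open import Data.Empty using (⊥)
open import Data.Unit using (⊤)
open import Relation.Nullary using (¬_; Dec; yes; no)
open import Relation.Nullary.Decidable using (⌊_⌋; _×-dec_)
open import Relation.Binary.PropositionalEquality using (_≡_)
open import Data.Bool.Properties using () renaming (_≟_ to _≟ᵇ_)
open import Function.Bundles using (_⇔_)

-- Propositions are natural numbers (an unbounded supply of names, so that
-- fresh propositions always exist).  A set of propositions is a List ℕ.

Prop : Set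
Prop = ℕ

PropSet : Set
PropSet = List Prop

-- Finite timed words.  Positions are Fin (suc size), i.e. positions
-- 1 .. size+1 of the paper are Fin.zero .. Fin.fromℕ size (nonempty word).

record TWord : Set where
  constructor tword
  field
    size : ℕ
    lab  : Fin (suc size) → Prop → Bool
    time : Fin (suc size) → ℚ

open TWord public

Pos : TWord → Set
Pos ρ = Fin (suc (size ρ))

-- ρ is a timed word over the proposition set S:
-- every label is a nonempty subset of S, τ₁ = 0, time stamps non-decreasing
-- (non-negativity follows).
record WordOver (S : PropSet) (ρ : TWord) : Set where
  field
    labels⊆   : ∀ (i : Pos ρ) (p : Prop) → lab ρ i p ≡ true → p ∈ S
    nonempty  : ∀ (i : Pos ρ) → ∃ λ p → lab ρ i p ≡ true
    init0     : time ρ Fin.zero ≡ 0ℚ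
    monotone  : ∀ (i j : Pos ρ) → i Fin.≤ j → time ρ i ℚ.≤ time ρ j

record Interval : Set where
  constructor interval
  field
    lower       : ℕ
    lowerClosed : Bool
    upper       : Maybe ℕ      -- nothing = ∞ (then the right end is open)
    upperClosed : Bool

ℕtoℚ : ℕ → ℚ
ℕtoℚ n = + n / 1

lowOK : ℚ → ℕ → Bool → Set
lowOK d l true  = ℕtoℚ l ℚ.≤ d
lowOK d l false = ℕtoℚ l ℚ.< d

highOK : ℚ → Maybe ℕ → Bool → Set
highOK d nothing  _     = ⊤
highOK d (just r) true  = d ℚ.≤ ℕtoℚ r
highOK d (just r) false = d ℚ.< ℕtoℚ r

_∈I_ : ℚ → Interval → Set
d ∈I interval l lc u uc = lowOK d l lc × highOK d u uc

data MTL : Set where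
  tt    : MTL
  prop  : Prop → MTL
  ¬'    : MTL → MTL
  _∧'_  : MTL → MTL → MTL
  U[_]  : Interval → MTL → MTL → MTL

props : MTL → PropSet
props tt            = Data.List.[]
props (prop p)      = p Data.List.∷ Data.List.[]
props (¬' φ)        = props φ
props (φ ∧' ψ)      = props φ ++ props ψ
props (U[ I ] φ ψ)  = props φ ++ props ψ

_⟨_⟩⊨_ : (ρ : TWord) → Pos ρ → MTL → Set
ρ ⟨ i ⟩⊨ tt          = ⊤
ρ ⟨ i ⟩⊨ prop p      = lab ρ i p ≡ true
ρ ⟨ i ⟩⊨ ¬' φ        = ¬ (ρ ⟨ i ⟩⊨ φ)
ρ ⟨ i ⟩⊨ (φ ∧' ψ)    = (ρ ⟨ i ⟩⊨ φ) × (ρ ⟨ i ⟩⊨ ψ)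
ρ ⟨ i ⟩⊨ U[ I ] φ ψ  =
  ∃ λ (j : Pos ρ) → i Fin.< j × (ρ ⟨ j ⟩⊨ ψ) × ((time ρ j - time ρ i) ∈I I)
    × (∀ (k : Pos ρ) → i Fin.< k → k Fin.< j → ρ ⟨ k ⟩⊨ φ)

_⊨_ : TWord → MTL → Set
ρ ⊨ φ = ρ ⟨ Fin.zero ⟩⊨ φ

countBetween : (ρ : TWord) → Prop → Pos ρ → Pos ρ → ℕ
countBetween ρ b i j =
  length (filter (λ l → (i <ᶠ? l) ×-dec ((l <ᶠ? j) ×-dec (lab ρ l b ≟ᵇ true)))
                 (Data.List.allFin (suc (size ρ))))

UMsat : (ρ : TWord) → Pos ρ → (x y b : Prop) (I : Interval) (k n : ℕ)
        → .{{NonZero n}} → Set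
UMsat ρ i x y b I k n =
  ∃ λ (j : Pos ρ) → i Fin.< j × ((time ρ j - time ρ i) ∈I I)
    × (lab ρ j y ≡ true)
    × (∀ (l : Pos ρ) → i Fin.< l → l Fin.< j → lab ρ l x ≡ true)
    × (countBetween ρ b i j % n ≡ k)

-- ρ ⊨ □ⁿˢ [ a ↔ x UM_{I,#b=k%n} y ]  (evaluated at the first position,
-- hence at every position of ρ)
TDef⊨ : (ρ : TWord) → (a x y b : Prop) (I : Interval) (k n : ℕ)
        → .{{NonZero n}} → Set
TDef⊨ ρ a x y b I k n =
  ∀ (i : Pos ρ) → (lab ρ i a ≡ true) ⇔ UMsat ρ i x y b I k n

extend : (ρ : TWord) → (Pos ρ → Prop → Bool) → TWord
extend ρ Y = tword (size ρ) (λ i p → lab ρ i p ∨ Y i p) (time ρ)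

ExtraLabels : (Σ₀ Σ' : PropSet) (ρ : TWord) → (Pos ρ → Prop → Bool) → Set
ExtraLabels Σ₀ Σ' ρ Y = ∀ (i : Pos ρ) (p : Prop) → Y i p ≡ true → (p ∈ Σ') × ¬ (p ∈ Σ₀)

restrict : PropSet → TWord → TWord
restrict S ρ = tword (size ρ) (λ i p → lab ρ i p ∧ ⌊ p ∈? S ⌋) (time ρ)

EquivModSimpleExt : (Σ₀ Σ' : PropSet) → (TWord → Set) → MTL → Set
EquivModSimpleExt Σ₀ Σ' P ψ =
  (∀ (ρ : TWord) → WordOver Σ₀ ρ →
     P ρ ⇔ (∃ λ (Y : Pos ρ → Prop → Bool) → ExtraLabels Σ₀ Σ' ρ Y × (extend ρ Y ⊨ ψ)))
  × (∀ (ρ' : TWord) → WordOver Σ' ρ' → ρ' ⊨ ψ → P (restrict Σ₀ ρ'))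

-- Fresh propositions counter 0, …, counter (n-1) are used to label every position l with the
-- residue modulo n of the number of b's strictly before l.  MTL can maintain this labelling
-- locally: counter 0 holds at the first position, at most one counter holds anywhere, and a
-- position carrying counter m whose b-value is β forces counter ((m + β) mod n) at the next
-- position.  The number of b's strictly between i and j is then ≡ k (mod n) exactly when j
-- carries counter ((m + β + k) mod n), so  x UM_{I,#b=k%n} y  at i becomes the ordinary
-- x U_I (y ∧ counter ((m + β + k) mod n)).  Every word over Σ ∪ W carries exactly one such
-- labelling, which is the required simple extension.

module Submission where

open import Defs
open import Data.Bool using (Bool; true; false; _∧_; _∨_)
open import Data.Bool.Properties using (∨-identityʳ; ∧-identityʳ; ¬-not; not-¬) renaming (_≟_ to _≟ᵇ_)
open import Data.Nat using (ℕ; zero; suc; NonZero; _+_; _*_; _∸_; _<_; z≤n; z<s; >-nonZero⁻¹)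
import Data.Nat.Properties as ℕ
open import Data.Nat.DivMod
  using (_%_; _/_; m%n<n; m<n⇒m%n≡m; %-distribˡ-+; m%n%n≡m%n; [m+kn]%n≡m%n; m≡m%n+[m/n]*n)
open import Data.Fin as Fin using (Fin; toℕ; inject₁)
open import Data.Fin.Properties using (any?; all?; toℕ-inject₁; toℕ-injective; suc-injective)
  renaming (_<?_ to _<ᶠ?_; _≤?_ to _≤ᶠ?_; _≟_ to _≟ᶠ_)
open import Data.Fin.Induction using (<-weakInduction)
open import Data.Rational as ℚ using (_-_)
import Data.Rational.Properties as ℚ
open import Data.Maybe using (just; nothing)
open import Data.List using (List; []; _∷_; length; filter; _++_; allFin; tabulate; applyUpTo)
open import Data.List.Properties using (filter-none; filter-≐)
open import Data.List.Extrema.Nat using (max; xs≤max)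
open import Data.List.Membership.Propositional using (_∈_; _∉_)
open import Data.List.Membership.Propositional.Properties
  using (∈-++⁺ˡ; ∈-++⁺ʳ; ∈-applyUpTo⁺; ∈-applyUpTo⁻)
open import Data.List.Membership.DecPropositional ℕ._≟_ using (_∈?_)
open import Data.List.Relation.Unary.All using (All; []; _∷_; lookup)
open import Data.List.Relation.Unary.All.Properties using (tabulate⁺) renaming (++⁺ to infixr 5 _++⁺_)
open import Data.List.Relation.Binary.Subset.Propositional using (_⊆_)
open import Data.Product using (∃; _×_; _,_; proj₁; proj₂; Σ-syntax; map₂)
open import Data.Sum as Sum using (inj₁; inj₂; [_,_]; [_,_]′) renaming (map to ⊎-map)
open import Data.Unit using (tt)
open import Relation.Nullary using (¬_; Dec; yes; no; does; contradiction)
open import Relation.Nullary.Decidable using (_×-dec_; _→-dec_; ¬?; decidable-stable; dec-true; isYes≗does)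
open import Relation.Unary using (Pred; Decidable; _≐_; _∪_; _⊥_)
open import Relation.Binary.PropositionalEquality
  using (_≡_; refl; sym; trans; cong; subst; subst₂; module ≡-Reasoning)
open import Relation.Binary using (tri<; tri≈; tri>)
open import Function using (_∘_)
open import Function.Bundles using (_⇔_; mk⇔; Equivalence)
import Function.Properties.Equivalence as ⇔
open import Level using (Level)

open Equivalence

private
  variable
    ℓ ℓ₁ ℓ₂ ℓ₃ : Level

lowOK? : ∀ d l c → Dec (lowOK d l c)
lowOK? d l true  = ℕtoℚ l ℚ.≤? d
lowOK? d l false = ℕtoℚ l ℚ.<? d

highOK? : ∀ d u c → Dec (highOK d u c)
highOK? d nothing  _     = yes tt
highOK? d (just r) true  = d ℚ.≤? ℕtoℚ r
highOK? d (just r) false = d ℚ.<? ℕtoℚ r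

_∈I?_ : ∀ d I → Dec (d ∈I I)
d ∈I? interval l lc u uc = lowOK? d l lc ×-dec highOK? d u uc

_⟨_⟩⊨?_ : ∀ ρ i φ → Dec (ρ ⟨ i ⟩⊨ φ)
ρ ⟨ i ⟩⊨? tt         = yes tt
ρ ⟨ i ⟩⊨? prop p     = lab ρ i p ≟ᵇ true
ρ ⟨ i ⟩⊨? ¬' φ       = ¬? (ρ ⟨ i ⟩⊨? φ)
ρ ⟨ i ⟩⊨? (φ ∧' ψ)   = (ρ ⟨ i ⟩⊨? φ) ×-dec (ρ ⟨ i ⟩⊨? ψ)
ρ ⟨ i ⟩⊨? U[ I ] φ ψ = any? λ j →
  (i <ᶠ? j) ×-dec ((ρ ⟨ j ⟩⊨? ψ) ×-dec (((time ρ j - time ρ i) ∈I? I) ×-dec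
    all? λ k → (i <ᶠ? k) →-dec ((k <ᶠ? j) →-dec (ρ ⟨ k ⟩⊨? φ))))

does≡true⇔ : ∀ {P : Set ℓ} (P? : Dec P) → does P? ≡ true ⇔ P
does≡true⇔ (yes p) = mk⇔ (λ _ → p) (λ _ → refl)
does≡true⇔ (no ¬p) = mk⇔ (λ ()) (λ p → contradiction p ¬p)

-- Needed because implication, weak next and □ below are encoded through ¬'.
⊨-stable : ∀ ρ i φ → ¬ ¬ (ρ ⟨ i ⟩⊨ φ) → ρ ⟨ i ⟩⊨ φ
⊨-stable ρ i φ = decidable-stable (ρ ⟨ i ⟩⊨? φ)

infixr 5 _⇒'_ _⇔'_

⊥' : MTL
⊥' = ¬' tt

_⇒'_ : MTL → MTL → MTL
φ ⇒' ψ = ¬' (φ ∧' ¬' ψ)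

_⇔'_ : MTL → MTL → MTL
φ ⇔' ψ = (φ ⇒' ψ) ∧' (ψ ⇒' φ)

nonNegative : Interval
nonNegative = interval 0 true nothing false

weakNext : MTL → MTL
weakNext φ = ¬' (U[ nonNegative ] ⊥' (¬' φ))

□ : MTL → MTL
□ φ = φ ∧' ¬' (U[ nonNegative ] tt (¬' φ))

⋀ : ℕ → (ℕ → MTL) → MTL
⋀ zero    f = tt
⋀ (suc n) f = f n ∧' ⋀ n f

⋀-props : ∀ {P : Pred Prop ℓ} n f → (∀ m → m < n → All P (props (f m))) → All P (props (⋀ n f))
⋀-props zero    f all-f = []
⋀-props (suc n) f all-f = all-f n ℕ.≤-refl ++⁺ ⋀-props n f λ m m<n → all-f m (ℕ.m≤n⇒m≤1+n m<n)

Monotone : TWord → Set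
Monotone ρ = ∀ (i j : Pos ρ) → i Fin.≤ j → time ρ i ℚ.≤ time ρ j

_⋖_ : ∀ {m} → Fin m → Fin m → Set
_⋖_ {m} i j = i Fin.< j × (∀ (k : Fin m) → ¬ (i Fin.< k × k Fin.< j))

inject₁⋖suc : ∀ {m} (i : Fin m) → inject₁ i ⋖ Fin.suc i
inject₁⋖suc i rewrite toℕ-inject₁ i = ℕ.≤-refl , λ k (i<k , k<1+i) → ℕ.<⇒≱ i<k (ℕ.≤-pred k<1+i)

module _ (ρ : TWord) where

  ⊨-⇒ : ∀ {i} φ ψ → ρ ⟨ i ⟩⊨ (φ ⇒' ψ) ⇔ (ρ ⟨ i ⟩⊨ φ → ρ ⟨ i ⟩⊨ ψ)
  ⊨-⇒ {i} φ ψ = mk⇔ (λ h p → ⊨-stable ρ i ψ (λ ¬q → h (p , ¬q))) (λ f (p , ¬q) → ¬q (f p))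

  ⊨-⇔ : ∀ {i} φ ψ → ρ ⟨ i ⟩⊨ (φ ⇔' ψ) ⇔ (ρ ⟨ i ⟩⊨ φ ⇔ ρ ⟨ i ⟩⊨ ψ)
  ⊨-⇔ φ ψ = mk⇔ (λ (h , h′) → mk⇔ (to (⊨-⇒ φ ψ) h) (to (⊨-⇒ ψ φ) h′))
                 (λ e → from (⊨-⇒ φ ψ) (to e) , from (⊨-⇒ ψ φ) (from e))

  ⊨-⋀ : ∀ {i} n f → ρ ⟨ i ⟩⊨ ⋀ n f ⇔ (∀ m → m < n → ρ ⟨ i ⟩⊨ f m)
  ⊨-⋀ zero    f = mk⇔ (λ _ m ()) (λ _ → tt)
  ⊨-⋀ {i} (suc n) f =
    mk⇔ elim (λ h → h n ℕ.≤-refl , from (⊨-⋀ n f) (λ m m<n → h m (ℕ.m≤n⇒m≤1+n m<n)))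
    where
    elim : ρ ⟨ i ⟩⊨ ⋀ (suc n) f → ∀ m → m < suc n → ρ ⟨ i ⟩⊨ f m
    elim (fn , rest) m m<1+n with ℕ.m<1+n⇒m<n∨m≡n m<1+n
    ... | inj₁ m<n  = to (⊨-⋀ n f) rest m m<n
    ... | inj₂ refl = fn

  ⊨-∧-Bool : ∀ {i} (f : Bool → MTL) → ρ ⟨ i ⟩⊨ (f true ∧' f false) ⇔ (∀ β → ρ ⟨ i ⟩⊨ f β)
  ⊨-∧-Bool f = mk⇔ (λ { (f₁ , _) true → f₁ ; (_ , f₀) false → f₀ }) (λ h → h true , h false)

  module _ (mono : Monotone ρ) where

    elapsed-nonNegative : ∀ {i j} → i Fin.≤ j → (time ρ j - time ρ i) ∈I nonNegative
    elapsed-nonNegative {i} {j} i≤j =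
      subst (ℚ._≤ time ρ j - time ρ i) (ℚ.+-inverseʳ (time ρ i))
            (ℚ.+-monoˡ-≤ (ℚ.- time ρ i) (mono i j i≤j)) , tt

    ⊨-weakNext : ∀ {i} φ → ρ ⟨ i ⟩⊨ weakNext φ ⇔ (∀ j → i ⋖ j → ρ ⟨ j ⟩⊨ φ)
    ⊨-weakNext φ = mk⇔
      (λ h j (i<j , gap) → ⊨-stable ρ j φ λ ¬φ →
         h (j , i<j , ¬φ , elapsed-nonNegative (ℕ.<⇒≤ i<j) , λ (k : Pos ρ) i<k k<j _ → gap k (i<k , k<j)))
      (λ f (j , i<j , ¬φ , _ , between) → ¬φ (f j (i<j , λ (k : Pos ρ) (i<k , k<j) → between k i<k k<j tt)))

    ⊨-□ : ∀ φ → ρ ⊨ □ φ ⇔ (∀ j → ρ ⟨ j ⟩⊨ φ)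
    ⊨-□ φ = mk⇔ everywhere (λ f → f Fin.zero , λ (j , _ , ¬φ , _) → ¬φ (f j))
      where
      everywhere : ρ ⊨ □ φ → ∀ j → ρ ⟨ j ⟩⊨ φ
      everywhere (φ₀ , _)     Fin.zero    = φ₀
      everywhere (_  , never) (Fin.suc j) = ⊨-stable ρ (Fin.suc j) φ λ ¬φ →
        never (Fin.suc j , z<s , ¬φ , elapsed-nonNegative z≤n , λ _ _ _ → tt)

indicator : Bool → ℕ
indicator true  = 1
indicator false = 0

module _ {A : Set} where

  length-filter-∪ : {P : Pred A ℓ₁} {Q : Pred A ℓ₂} {R : Pred A ℓ₃}
                    (P? : Decidable P) (Q? : Decidable Q) (R? : Decidable R) →
                    P ≐ Q ∪ R → Q ⊥ R → ∀ xs →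
                    length (filter P? xs) ≡ length (filter Q? xs) + length (filter R? xs)
  length-filter-∪ P? Q? R? P≐Q∪R Q⊥R [] = refl
  length-filter-∪ P? Q? R? (P⊆ , ⊆P) Q⊥R (x ∷ xs)
    with ih ← length-filter-∪ P? Q? R? (P⊆ , ⊆P) Q⊥R xs | P? x | Q? x | R? x
  ... | yes _  | yes _  | no _   = cong suc ih
  ... | yes _  | no _   | yes _  = trans (cong suc ih) (sym (ℕ.+-suc _ _))
  ... | no _   | no _   | no _   = ih
  ... | yes px | no ¬qx | no ¬rx = contradiction (P⊆ px) [ ¬qx , ¬rx ]
  ... | no ¬px | yes qx | _      = contradiction (⊆P (inj₁ qx)) ¬px
  ... | no ¬px | no _   | yes rx = contradiction (⊆P (inj₂ rx)) ¬px
  ... | yes _  | yes qx | yes rx = contradiction (qx , rx) Q⊥R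

  length-filter-none : {P : Pred A ℓ} (P? : Decidable P) {m : ℕ} (f : Fin m → A) →
                       (∀ l → ¬ P (f l)) → length (filter P? (tabulate f)) ≡ 0
  length-filter-none P? f never = cong length (filter-none P? (tabulate⁺ never))

  length-filter-unique : {P : Pred A ℓ} (P? : Decidable P) {m : ℕ} (f : Fin m → A) {i : Fin m} →
                         (∀ l → P (f l) → l ≡ i) →
                         length (filter P? (tabulate f)) ≡ indicator (does (P? (f i)))
  length-filter-unique P? f {Fin.zero} unique
    with P? (f Fin.zero)
       | length-filter-none P? (f ∘ Fin.suc) (λ l p → contradiction (unique (Fin.suc l) p) λ ())
  ... | yes _ | rest-empty = cong suc rest-empty
  ... | no _  | rest-empty = rest-empty
  length-filter-unique P? f {Fin.suc i} unique with P? (f Fin.zero)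
  ... | yes p = contradiction (unique Fin.zero p) λ ()
  ... | no _  = length-filter-unique P? (f ∘ Fin.suc) λ l p → suc-injective (unique (Fin.suc l) p)

module Count {m : ℕ} {D : Pred (Fin m) ℓ} (D? : Decidable D) where

  before : Fin m → ℕ
  before j = length (filter (λ l → (l <ᶠ? j) ×-dec D? l) (allFin m))

  between : Fin m → Fin m → ℕ
  between i j = length (filter (λ l → (i <ᶠ? l) ×-dec ((l <ᶠ? j) ×-dec D? l)) (allFin m))

  before-split : ∀ {i j} → i Fin.< j → before j ≡ before i + indicator (does (D? i)) + between i j
  before-split {i} {j} i<j = begin
    before j
      ≡⟨ length-filter-∪ _ _ from-i? split-at-i disjoint-at-i (allFin m) ⟩
    before i + #from-i
      ≡⟨ cong (before i +_) (length-filter-∪ from-i? at-i? _ split-after-i disjoint-after-i (allFin m)) ⟩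
    before i + (#at-i + between i j)
      ≡⟨ cong (λ c → before i + (c + between i j)) #at-i≡ ⟩
    before i + (indicator (does (D? i)) + between i j)
      ≡⟨ ℕ.+-assoc (before i) _ _ ⟨
    before i + indicator (does (D? i)) + between i j
      ∎
    where
    open ≡-Reasoning
    Below : Fin m → Pred (Fin m) ℓ
    Below j l = l Fin.< j × D l
    From-i At-i After-i : Pred (Fin m) ℓ
    From-i l  = i Fin.≤ l × Below j l
    At-i l    = l ≡ i × D l
    After-i l = i Fin.< l × Below j l

    from-i? : Decidable From-i
    from-i? l = (i ≤ᶠ? l) ×-dec ((l <ᶠ? j) ×-dec D? l)
    at-i? : Decidable At-i
    at-i? l = (l ≟ᶠ i) ×-dec D? l
    #from-i #at-i : ℕ
    #from-i = length (filter from-i? (allFin m))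
    #at-i   = length (filter at-i? (allFin m))

    split-at-i : Below j ≐ Below i ∪ From-i
    split-at-i = (λ {l} (l<j , d) → ⊎-map (_, d) (_, l<j , d) (ℕ.<-≤-connex (toℕ l) (toℕ i)))
               , [ (λ (l<i , d) → ℕ.<-trans l<i i<j , d) , proj₂ ]′
    disjoint-at-i : Below i ⊥ From-i
    disjoint-at-i ((l<i , _) , (i≤l , _)) = ℕ.<⇒≱ l<i i≤l

    split-after-i : From-i ≐ At-i ∪ After-i
    split-after-i = (λ (i≤l , below) → ⊎-map (λ i≡l → toℕ-injective (sym i≡l) , proj₂ below) (_, below)
                                              (Sum.swap (ℕ.m≤n⇒m<n∨m≡n i≤l)))
                  , [ (λ { (refl , d) → ℕ.≤-refl , i<j , d }) , (λ (i<l , below) → ℕ.<⇒≤ i<l , below) ]′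
    disjoint-after-i : At-i ⊥ After-i
    disjoint-after-i ((refl , _) , (i<i , _)) = ℕ.<-irrefl refl i<i

    #at-i≡ : #at-i ≡ indicator (does (D? i))
    #at-i≡ = trans (length-filter-unique at-i? (λ l → l) (λ _ → proj₁))
                   (cong (λ e → indicator (e ∧ does (D? i))) (dec-true (i ≟ᶠ i) refl))

  between-⋖ : ∀ {i j} → i ⋖ j → between i j ≡ 0
  between-⋖ {i} {j} (_ , gap) =
    length-filter-none (λ l → (i <ᶠ? l) ×-dec ((l <ᶠ? j) ×-dec D? l)) (λ l → l)
                       (λ l (i<l , l<j , _) → gap l (i<l , l<j))

  before-⋖ : ∀ {i j} → i ⋖ j → before j ≡ before i + indicator (does (D? i))
  before-⋖ {i} {j} i⋖j =
    trans (before-split (proj₁ i⋖j)) (trans (cong (_ +_) (between-⋖ i⋖j)) (ℕ.+-identityʳ _))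

before-zero : ∀ {n} {D : Pred (Fin (suc n)) ℓ} (D? : Decidable D) → Count.before D? Fin.zero ≡ 0
before-zero {n = n} D? =
  length-filter-none (λ l → (l <ᶠ? Fin.zero {n}) ×-dec D? l) (λ l → l) (λ l (l<0 , _) → ℕ.n≮0 l<0)

module _ {m : ℕ} {D : Pred (Fin m) ℓ₁} {E : Pred (Fin m) ℓ₂}
         (D? : Decidable D) (E? : Decidable E) (D≐E : D ≐ E) where

  before-cong : ∀ j → Count.before D? j ≡ Count.before E? j
  before-cong j = cong length (filter-≐ _ _ (map₂ (proj₁ D≐E) , map₂ (proj₂ D≐E)) (allFin m))

  between-cong : ∀ i j → Count.between D? i j ≡ Count.between E? i j
  between-cong i j =
    cong length (filter-≐ _ _ (map₂ (map₂ (proj₁ D≐E)) , map₂ (map₂ (proj₂ D≐E))) (allFin m))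

module _ {n : ℕ} .{{_ : NonZero n}} where
  open ≡-Reasoning

  [m%n+o]%n≡[m+o]%n : ∀ m o → (m % n + o) % n ≡ (m + o) % n
  [m%n+o]%n≡[m+o]%n m o = begin
    (m % n + o) % n          ≡⟨ %-distribˡ-+ (m % n) o n ⟩
    (m % n % n + o % n) % n  ≡⟨ cong (λ r → (r + o % n) % n) (m%n%n≡m%n m n) ⟩
    (m % n + o % n) % n      ≡⟨ %-distribˡ-+ m o n ⟨
    (m + o) % n              ∎

  +-congˡ-% : ∀ m {c d} → c % n ≡ d % n → (m + c) % n ≡ (m + d) % n
  +-congˡ-% m {c} {d} c≡d = begin
    (m + c) % n          ≡⟨ %-distribˡ-+ m c n ⟩
    (m % n + c % n) % n  ≡⟨ cong (λ r → (m % n + r) % n) c≡d ⟩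
    (m % n + d % n) % n  ≡⟨ %-distribˡ-+ m d n ⟨
    (m + d) % n          ∎

  -- adding n ∸ m % n rounds m up to a multiple of n
  complement-cancels : ∀ m c → ((n ∸ m % n) + (m + c)) % n ≡ c % n
  complement-cancels m c = begin
    ((n ∸ m % n) + (m + c)) % n   ≡⟨ cong (_% n) (ℕ.+-assoc (n ∸ m % n) m c) ⟨
    ((n ∸ m % n) + m + c) % n     ≡⟨ cong (λ t → (t + c) % n) round-up ⟩
    (suc (m / n) * n + c) % n     ≡⟨ cong (_% n) (ℕ.+-comm (suc (m / n) * n) c) ⟩
    (c + suc (m / n) * n) % n     ≡⟨ [m+kn]%n≡m%n c (suc (m / n)) n ⟩
    c % n                         ∎
    where
    round-up : (n ∸ m % n) + m ≡ suc (m / n) * n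
    round-up = begin
      (n ∸ m % n) + m                      ≡⟨ cong ((n ∸ m % n) +_) (m≡m%n+[m/n]*n m n) ⟩
      (n ∸ m % n) + (m % n + (m / n) * n)  ≡⟨ ℕ.+-assoc (n ∸ m % n) (m % n) _ ⟨
      (n ∸ m % n) + m % n + (m / n) * n    ≡⟨ cong (_+ (m / n) * n) (ℕ.m∸n+n≡m (ℕ.<⇒≤ (m%n<n m n))) ⟩
      n + (m / n) * n                      ∎

  +-cancelˡ-% : ∀ m {c d} → (m + c) % n ≡ (m + d) % n → c % n ≡ d % n
  +-cancelˡ-% m {c} {d} eq = begin
    c % n                          ≡⟨ complement-cancels m c ⟨
    ((n ∸ m % n) + (m + c)) % n    ≡⟨ +-congˡ-% (n ∸ m % n) eq ⟩
    ((n ∸ m % n) + (m + d)) % n    ≡⟨ complement-cancels m d ⟩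
    d % n                          ∎

labelled? : (ρ : TWord) (p : Prop) → Decidable (λ (l : Pos ρ) → lab ρ l p ≡ true)
labelled? ρ p l = lab ρ l p ≟ᵇ true

countBefore : (ρ : TWord) → Prop → Pos ρ → ℕ
countBefore ρ b = Count.before (labelled? ρ b)

does-≟-true : ∀ β → does (β ≟ᵇ true) ≡ β
does-≟-true true  = refl
does-≟-true false = refl

module _ (ρ : TWord) (b : Prop) where

  countBefore-split : ∀ {i j} → i Fin.< j →
                      countBefore ρ b j ≡ countBefore ρ b i + indicator (lab ρ i b) + countBetween ρ b i j
  countBefore-split {i} i<j =
    trans (Count.before-split (labelled? ρ b) i<j)
          (cong (λ β → countBefore ρ b i + indicator β + countBetween ρ b i _) (does-≟-true (lab ρ i b)))

  countBefore-⋖ : ∀ {i j} → i ⋖ j → countBefore ρ b j ≡ countBefore ρ b i + indicator (lab ρ i b)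
  countBefore-⋖ {i} i⋖j =
    trans (Count.before-⋖ (labelled? ρ b) i⋖j)
          (cong (λ β → countBefore ρ b i + indicator β) (does-≟-true (lab ρ i b)))

AgreeOn : ∀ {m} → PropSet → (L₁ L₂ : Fin m → Prop → Bool) → Set
AgreeOn S L₁ L₂ = ∀ {p} → p ∈ S → ∀ l → L₁ l p ≡ L₂ l p

sym-agree : ∀ {m S} {L₁ L₂ : Fin m → Prop → Bool} → AgreeOn S L₁ L₂ → AgreeOn S L₂ L₁
sym-agree agree p∈ l = sym (agree p∈ l)

labelled-≐ : ∀ {m} {f g : Fin m → Bool} → (∀ l → f l ≡ g l) →
             (λ l → f l ≡ true) ≐ (λ l → g l ≡ true)
labelled-≐ f≗g = (λ {l} → trans (sym (f≗g l))) , (λ {l} → trans (f≗g l))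

module _ (ρ : TWord) {S : PropSet} {L₁ L₂ : Pos ρ → Prop → Bool} (agree : AgreeOn S L₁ L₂) where

  private
    ρ₁ ρ₂ : TWord
    ρ₁ = tword (size ρ) L₁ (time ρ)
    ρ₂ = tword (size ρ) L₂ (time ρ)

  countBefore-cong : ∀ {b} → b ∈ S → ∀ j → countBefore ρ₁ b j ≡ countBefore ρ₂ b j
  countBefore-cong b∈ = before-cong _ _ (labelled-≐ (agree b∈))

  UMsat-cong : ∀ {x y b I k n} .{{_ : NonZero n}} → x ∈ S → y ∈ S → b ∈ S →
               ∀ i → UMsat ρ₁ i x y b I k n → UMsat ρ₂ i x y b I k n
  UMsat-cong {n = n} x∈ y∈ b∈ i (j , i<j , inI , yⱼ , xs , #b≡k) =
    j , i<j , inI , trans (sym (agree y∈ j)) yⱼ , (λ l i<l l<j → trans (sym (agree x∈ l)) (xs l i<l l<j)) ,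
    trans (cong (_% n) (sym (between-cong _ _ (labelled-≐ (agree b∈)) i j))) #b≡k

TDef-cong : ∀ ρ {S} {L₁ L₂ : Pos ρ → Prop → Bool} → AgreeOn S L₁ L₂ →
            ∀ {a x y b I k n} .{{_ : NonZero n}} → a ∈ S → x ∈ S → y ∈ S → b ∈ S →
            TDef⊨ (tword (size ρ) L₁ (time ρ)) a x y b I k n → TDef⊨ (tword (size ρ) L₂ (time ρ)) a x y b I k n
TDef-cong ρ agree a∈ x∈ y∈ b∈ tdef i = mk⇔
  (λ aᵢ → UMsat-cong ρ agree x∈ y∈ b∈ i (to (tdef i) (trans (agree a∈ i) aᵢ)))
  (λ um → trans (sym (agree a∈ i)) (from (tdef i) (UMsat-cong ρ (sym-agree agree) x∈ y∈ b∈ i um)))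

module CounterFormula (a x y b : Prop) (I : Interval) (k n : ℕ) .{{_ : NonZero n}} (k<n : k < n) (N : Prop) where

  counter : ℕ → Prop
  counter m = N + m

  literal : Bool → MTL
  literal true  = prop b
  literal false = ¬' (prop b)

  next : ℕ → Bool → ℕ
  next m β = (m + indicator β) % n

  target : ℕ → Bool → ℕ
  target m β = (m + indicator β + k) % n

  untilTarget : ℕ → Bool → MTL
  untilTarget m β = U[ I ] (prop x) (prop y ∧' prop (counter (target m β)))

  effect : ℕ → Bool → MTL
  effect m β = weakNext (prop (counter (next m β))) ∧' (prop a ⇔' untilTarget m β)

  step : ℕ → Bool → MTL
  step m β = (prop (counter m) ∧' literal β) ⇒' effect m β

  atMostOneCounter : MTL
  atMostOneCounter = ⋀ n λ m → ⋀ m λ m′ → ¬' (prop (counter m) ∧' prop (counter m′))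

  invariant : MTL
  invariant = atMostOneCounter ∧' ⋀ n (λ m → step m true ∧' step m false)

  ψ : MTL
  ψ = prop (counter 0) ∧' □ invariant

  Tracks : TWord → Set
  Tracks ρ = ∀ l m → m < n → lab ρ l (counter m) ≡ true ⇔ countBefore ρ b l % n ≡ m

  countBefore-zero : ∀ ρ → countBefore ρ b Fin.zero % n ≡ 0
  countBefore-zero ρ = trans (cong (_% n) (before-zero (labelled? ρ b))) (m<n⇒m%n≡m (>-nonZero⁻¹ n))

  module _ (ρ : TWord) where
    open ≡-Reasoning

    private
      #b : Pos ρ → ℕ
      #b = countBefore ρ b

    ⊨-literal : ∀ {l} β → ρ ⟨ l ⟩⊨ literal β ⇔ lab ρ l b ≡ β
    ⊨-literal {l} true  = mk⇔ (λ h → h) (λ h → h)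
    ⊨-literal {l} false = mk⇔ ¬-not not-¬

    ⊨-atMostOneCounter : ∀ {l} → ρ ⟨ l ⟩⊨ atMostOneCounter ⇔
      (∀ m m′ → m < n → m′ < n →
         lab ρ l (counter m) ≡ true → lab ρ l (counter m′) ≡ true → m ≡ m′)
    ⊨-atMostOneCounter {l} = mk⇔ unique λ h →
      from (⊨-⋀ ρ n _) λ m m<n → from (⊨-⋀ ρ m _) λ m′ m′<m (cₘ , cₘ′) →
        ℕ.<-irrefl (sym (h m m′ m<n (ℕ.<-trans m′<m m<n) cₘ cₘ′)) m′<m
      where
      below : ρ ⟨ l ⟩⊨ atMostOneCounter → ∀ {m m′} → m < n → m′ < m →
              ρ ⟨ l ⟩⊨ ¬' (prop (counter m) ∧' prop (counter m′))
      below h {m} {m′} m<n m′<m = to (⊨-⋀ ρ m _) (to (⊨-⋀ ρ n _) h m m<n) m′ m′<m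
      unique : ρ ⟨ l ⟩⊨ atMostOneCounter → ∀ m m′ → m < n → m′ < n →
               lab ρ l (counter m) ≡ true → lab ρ l (counter m′) ≡ true → m ≡ m′
      unique h m m′ m<n m′<n cₘ cₘ′ with ℕ.<-cmp m m′
      ... | tri< m<m′ _ _ = contradiction (cₘ′ , cₘ) (below h m′<n m<m′)
      ... | tri≈ _ m≡m′ _ = m≡m′
      ... | tri> _ _ m′<m = contradiction (cₘ , cₘ′) (below h m<n m′<m)

    next-correct : ∀ {i j} → i ⋖ j → #b j % n ≡ next (#b i % n) (lab ρ i b)
    next-correct {i} i⋖j = trans (cong (_% n) (countBefore-⋖ ρ b i⋖j)) (sym ([m%n+o]%n≡[m+o]%n (#b i) _))

    target-correct : ∀ {i j} → i Fin.< j →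
                     (#b j % n ≡ target (#b i % n) (lab ρ i b)) ⇔ (countBetween ρ b i j % n ≡ k)
    target-correct {i} {j} i<j = mk⇔
      (λ eq → begin
         countBetween ρ b i j % n  ≡⟨ +-cancelˡ-% (#b i + β) (trans (cong (_% n) (sym split)) (trans eq reach)) ⟩
         k % n                     ≡⟨ k%n≡k ⟩
         k                         ∎)
      (λ eq → begin
         #b j % n                             ≡⟨ cong (_% n) split ⟩
         (#b i + β + countBetween ρ b i j) % n ≡⟨ +-congˡ-% (#b i + β) (trans eq (sym k%n≡k)) ⟩
         (#b i + β + k) % n                   ≡⟨ reach ⟨
         target (#b i % n) (lab ρ i b)        ∎)
      where
      β : ℕ
      β = indicator (lab ρ i b)
      split : #b j ≡ #b i + β + countBetween ρ b i j
      split = countBefore-split ρ b i<j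
      k%n≡k : k % n ≡ k
      k%n≡k = m<n⇒m%n≡m k<n
      reach : target (#b i % n) (lab ρ i b) ≡ (#b i + β + k) % n
      reach = begin
        (#b i % n + β + k) % n    ≡⟨ cong (_% n) (ℕ.+-assoc (#b i % n) β k) ⟩
        (#b i % n + (β + k)) % n  ≡⟨ [m%n+o]%n≡[m+o]%n (#b i) (β + k) ⟩
        (#b i + (β + k)) % n      ≡⟨ cong (_% n) (ℕ.+-assoc (#b i) β k) ⟨
        (#b i + β + k) % n        ∎

    untilTarget-correct : Tracks ρ → ∀ i →
                          ρ ⟨ i ⟩⊨ untilTarget (#b i % n) (lab ρ i b) ⇔ UMsat ρ i x y b I k n
    untilTarget-correct tracks i = mk⇔
      (λ (j , i<j , (yⱼ , cⱼ) , inI , xs) →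
         j , i<j , inI , yⱼ , xs , to (target-correct i<j) (to (tracks j _ target<n) cⱼ))
      (λ (j , i<j , inI , yⱼ , xs , #b≡k) →
         j , i<j , (yⱼ , from (tracks j _ target<n) (from (target-correct i<j) #b≡k)) , inI , xs)
      where
      target<n : target (#b i % n) (lab ρ i b) < n
      target<n = m%n<n _ n

    module _ (mono : Monotone ρ) (sat : ρ ⊨ ψ) where

      invariant-everywhere : ∀ l → ρ ⟨ l ⟩⊨ invariant
      invariant-everywhere = to (⊨-□ ρ mono invariant) (proj₂ sat)

      effect-fires : ∀ l {m} → m < n → lab ρ l (counter m) ≡ true → ρ ⟨ l ⟩⊨ effect m (lab ρ l b)
      effect-fires l {m} m<n cₘ =
        to (⊨-⇒ ρ (prop (counter m) ∧' literal β) (effect m β)) stepβ (cₘ , from (⊨-literal β) refl)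
        where
        β : Bool
        β = lab ρ l b
        stepβ : ρ ⟨ l ⟩⊨ step m β
        stepβ = to (⊨-∧-Bool ρ (step m)) (to (⊨-⋀ ρ n _) (proj₂ (invariant-everywhere l)) m m<n) β

      counter-holds : ∀ l → lab ρ l (counter (#b l % n)) ≡ true
      counter-holds = <-weakInduction (λ l → lab ρ l (counter (#b l % n)) ≡ true) initial preserved
        where
        initial : lab ρ Fin.zero (counter (#b Fin.zero % n)) ≡ true
        initial = subst (λ c → lab ρ Fin.zero (counter c) ≡ true) (sym (countBefore-zero ρ)) (proj₁ sat)
        preserved : ∀ i → lab ρ (inject₁ i) (counter (#b (inject₁ i) % n)) ≡ true →
                    lab ρ (Fin.suc i) (counter (#b (Fin.suc i) % n)) ≡ true
        preserved i cᵢ =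
          subst (λ c → lab ρ (Fin.suc i) (counter c) ≡ true) (sym (next-correct (inject₁⋖suc i)))
                (to (⊨-weakNext ρ mono (prop (counter _))) (proj₁ (effect-fires (inject₁ i) (m%n<n _ n) cᵢ))
                    (Fin.suc i) (inject₁⋖suc i))

      ψ-tracks : Tracks ρ
      ψ-tracks l m m<n = mk⇔
        (λ cₘ → to ⊨-atMostOneCounter (proj₁ (invariant-everywhere l)) _ m (m%n<n _ n) m<n (counter-holds l) cₘ)
        (λ { refl → counter-holds l })

      ψ-sound : TDef⊨ ρ a x y b I k n
      ψ-sound i = ⇔.trans (to (⊨-⇔ ρ (prop a) (untilTarget (#b i % n) (lab ρ i b))) a⇔until)
                          (untilTarget-correct ψ-tracks i)
        where
        a⇔until : ρ ⟨ i ⟩⊨ (prop a ⇔' untilTarget (#b i % n) (lab ρ i b))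
        a⇔until = proj₂ (effect-fires i (m%n<n _ n) (counter-holds i))

    module _ (mono : Monotone ρ) (tracks : Tracks ρ) (tdef : TDef⊨ ρ a x y b I k n) where

      effect-holds : ∀ l → ρ ⟨ l ⟩⊨ effect (#b l % n) (lab ρ l b)
      effect-holds l =
        from (⊨-weakNext ρ mono (prop (counter _))) (λ j l⋖j → from (tracks j _ (m%n<n _ n)) (next-correct l⋖j)) ,
        from (⊨-⇔ ρ (prop a) (untilTarget (#b l % n) (lab ρ l b)))
             (⇔.trans (tdef l) (⇔.sym (untilTarget-correct tracks l)))

      ψ-complete : ρ ⊨ ψ
      ψ-complete = from (tracks Fin.zero 0 (>-nonZero⁻¹ n)) (countBefore-zero ρ) ,
                   from (⊨-□ ρ mono invariant) λ l → atMostOne l , from (⊨-⋀ ρ n _) λ m m<n → steps l m<n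
        where
        atMostOne : ∀ l → ρ ⟨ l ⟩⊨ atMostOneCounter
        atMostOne l = from ⊨-atMostOneCounter λ m m′ m<n m′<n cₘ cₘ′ →
          trans (sym (to (tracks l m m<n) cₘ)) (to (tracks l m′ m′<n) cₘ′)
        steps : ∀ l {m} → m < n → ρ ⟨ l ⟩⊨ (step m true ∧' step m false)
        steps l {m} m<n = from (⊨-∧-Bool ρ (step m)) λ β →
          from (⊨-⇒ ρ (prop (counter m) ∧' literal β) (effect m β)) λ (cₘ , litβ) →
            subst₂ (λ m β → ρ ⟨ l ⟩⊨ effect m β) (to (tracks l m m<n) cₘ) (to (⊨-literal β) litβ)
                   (effect-holds l)

  module _ {S : PropSet} (a∈ : a ∈ S) (x∈ : x ∈ S) (y∈ : y ∈ S) (b∈ : b ∈ S)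
           (counter∈ : ∀ {m} → m < n → counter m ∈ S) where

    ψ-props : All (_∈ S) (props ψ)
    ψ-props = counter∈ (>-nonZero⁻¹ n) ∷ invariant-props ++⁺ invariant-props
      where
      literal-props : ∀ β → All (_∈ S) (props (literal β))
      literal-props true  = b∈ ∷ []
      literal-props false = b∈ ∷ []
      untilTarget-props : ∀ m β → All (_∈ S) (props (untilTarget m β))
      untilTarget-props m β = x∈ ∷ y∈ ∷ counter∈ (m%n<n _ n) ∷ []
      step-props : ∀ {m} → m < n → ∀ β → All (_∈ S) (props (step m β))
      step-props {m} m<n β = (counter∈ m<n ∷ literal-props β) ++⁺ counter∈ (m%n<n _ n) ∷
                             (a∈ ∷ untilTarget-props m β) ++⁺ untilTarget-props m β ++⁺ a∈ ∷ []
      invariant-props : All (_∈ S) (props invariant)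
      invariant-props =
        ⋀-props n _ (λ m m<n → ⋀-props m _ λ m′ m′<m →
                                counter∈ m<n ∷ counter∈ (ℕ.<-trans m′<m m<n) ∷ [])
        ++⁺ ⋀-props n _ (λ m m<n → step-props m<n true ++⁺ step-props m<n false)

extend-agrees : ∀ {Σ₀ Σ′} ρ {Y} → ExtraLabels Σ₀ Σ′ ρ Y → AgreeOn Σ₀ (lab (extend ρ Y)) (lab ρ)
extend-agrees ρ {Y} extra {p} p∈ l with Y l p in Yₗp
... | true  = contradiction p∈ (proj₂ (extra l p Yₗp))
... | false = ∨-identityʳ (lab ρ l p)

restrict-agrees : ∀ S ρ → AgreeOn S (lab ρ) (lab (restrict S ρ))
restrict-agrees S ρ {p} p∈ l =
  sym (trans (cong (lab ρ l p ∧_) (trans (isYes≗does (p ∈? S)) (dec-true (p ∈? S) p∈))) (∧-identityʳ _))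

module Synthesis (Σ₀ : PropSet) {a x y b : Prop}
                 (a∈ : a ∈ Σ₀) (x∈ : x ∈ Σ₀) (y∈ : y ∈ Σ₀) (b∈ : b ∈ Σ₀)
                 (I : Interval) {k n : ℕ} .{{_ : NonZero n}} (k<n : k < n) where

  open CounterFormula a x y b I k n k<n (suc (max 0 Σ₀)) public

  X : PropSet
  X = applyUpTo counter n

  counter-fresh : ∀ m → counter m ∉ Σ₀
  counter-fresh m c∈ = ℕ.<⇒≱ (ℕ.<-≤-trans (ℕ.n<1+n _) (ℕ.m≤m+n _ m)) (lookup (xs≤max 0 Σ₀) c∈)

  X-fresh : ∀ p → p ∈ X → p ∉ Σ₀
  X-fresh p p∈X with ∈-applyUpTo⁻ counter p∈X
  ... | m , _ , refl = counter-fresh m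

  counter∈ : ∀ {m} → m < n → counter m ∈ Σ₀ ++ X
  counter∈ m<n = ∈-++⁺ʳ Σ₀ (∈-applyUpTo⁺ counter m<n)

  ψ-props⊆ : props ψ ⊆ Σ₀ ++ X
  ψ-props⊆ = lookup (ψ-props (∈-++⁺ˡ a∈) (∈-++⁺ˡ x∈) (∈-++⁺ˡ y∈) (∈-++⁺ˡ b∈) counter∈)

  counterLabels : (ρ : TWord) → Pos ρ → Prop → Bool
  counterLabels ρ l p = does (p ℕ.≟ counter (countBefore ρ b l % n))

  counterLabels-extra : ∀ ρ → ExtraLabels Σ₀ (Σ₀ ++ X) ρ (counterLabels ρ)
  counterLabels-extra ρ l p labelled
    with refl ← to (does≡true⇔ (p ℕ.≟ counter (countBefore ρ b l % n))) labelled =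
    counter∈ (m%n<n _ n) , counter-fresh _

  counter-unlabelled : ∀ {ρ} → WordOver Σ₀ ρ → ∀ l m → lab ρ l (counter m) ≡ false
  counter-unlabelled {ρ} over l m with lab ρ l (counter m) in labelled
  ... | true  = contradiction (WordOver.labels⊆ over l _ labelled) (counter-fresh m)
  ... | false = refl

  counter-≟ : ∀ m c → does (counter m ℕ.≟ counter c) ≡ true ⇔ c ≡ m
  counter-≟ m c = ⇔.trans (does≡true⇔ (counter m ℕ.≟ counter c))
                          (mk⇔ (λ cₘ≡c → sym (ℕ.+-cancelˡ-≡ _ m c cₘ≡c)) λ { refl → refl })

  extension-tracks : ∀ ρ → WordOver Σ₀ ρ → Tracks (extend ρ (counterLabels ρ))
  extension-tracks ρ over l m m<n =
    subst₂ (λ β c → β ≡ true ⇔ c % n ≡ m)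
           (cong (_∨ counterLabels ρ l (counter m)) (sym (counter-unlabelled over l m)))
           (sym (countBefore-cong ρ (extend-agrees ρ (counterLabels-extra ρ)) b∈ l))
           (counter-≟ m (countBefore ρ b l % n))

  extension-satisfies : ∀ ρ → WordOver Σ₀ ρ → TDef⊨ ρ a x y b I k n →
                        ∃ λ Y → ExtraLabels Σ₀ (Σ₀ ++ X) ρ Y × (extend ρ Y ⊨ ψ)
  extension-satisfies ρ over tdef =
    counterLabels ρ , counterLabels-extra ρ ,
    ψ-complete (extend ρ (counterLabels ρ)) (WordOver.monotone over) (extension-tracks ρ over)
      (TDef-cong ρ (sym-agree (extend-agrees ρ (counterLabels-extra ρ))) a∈ x∈ y∈ b∈ tdef)

  ψ-equivalent : EquivModSimpleExt Σ₀ (Σ₀ ++ X) (λ ρ → TDef⊨ ρ a x y b I k n) ψ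
  ψ-equivalent =
    (λ ρ over → mk⇔ (extension-satisfies ρ over) λ (Y , extra , sat) →
       TDef-cong ρ (extend-agrees ρ extra) a∈ x∈ y∈ b∈ (ψ-sound (extend ρ Y) (WordOver.monotone over) sat)) ,
    (λ ρ′ over′ sat →
       TDef-cong ρ′ (restrict-agrees Σ₀ ρ′) a∈ x∈ y∈ b∈ (ψ-sound ρ′ (WordOver.monotone over′) sat))

lemma13 : (Σ W : List Prop) (a x y b : Prop) (I : Interval) (k n : ℕ)
            .{{_ : NonZero n}} → k < n
            → a ∈ W → x ∈ Σ ++ W → y ∈ Σ ++ W → b ∈ Σ ++ W
            → Σ[ X ∈ List Prop ] Σ[ ψ ∈ MTL ]
                 (∀ p → p ∈ X → p ∉ Σ ++ W)
                 × props ψ ⊆ (Σ ++ W) ++ X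
                 × EquivModSimpleExt (Σ ++ W) ((Σ ++ W) ++ X)
                     (λ ρ → TDef⊨ ρ a x y b I k n) ψ
lemma13 Σ W a x y b I k n k<n a∈W x∈ y∈ b∈ = X , ψ , X-fresh , ψ-props⊆ , ψ-equivalent
  where open Synthesis (Σ ++ W) (∈-++⁺ʳ Σ a∈W) x∈ y∈ b∈ I k<n
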